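{- Let $p$ be an odd prime, $\Omega_p$ an algebraic closure of $\mathbb{F}_p$, $P,Q\in\Omega_p\setminus\{0\}$ with $D=P^2-4Q\neq 0$, and let $r$ be a positive integer with $p\nmid r$. Then there exist $P_r,Q_r\in\Omega_p$ such that $Q_r^r=Q$ and $V_r(P_r,Q_r)=P$. Moreover, for any such $P_r,Q_r$ one has $U_r(P_r,Q_r)\neq 0$ and $$\frac{U_{nr}(P_r,Q_r)}{U_r(P_r,Q_r)}=U_n(P,Q)\quad\text{for every non-negative integer } n,$$ i.e. $U_n(P_r,Q_r)$ is an anti-derived sequence of order $r$ of $U_n(P,Q)$.
   Context: For $P,Q$ in a field, the Lucas sequences are $U_0=0$, $U_1=1$, $U_{n+2}=PU_{n+1}-QU_n$ and $V_0=2$, $V_1=P$, $V_{n+2}=PV_{n+1}-QV_n$. A Lucas sequence $U_n(P',Q')$ is called an anti-derived sequence of order $r$ of $U_n(P,Q)$ if $U_r(P',Q')\neq0$ and $U_{nr}(P',Q')/U_r(P',Q')=U_n(P,Q)$ for all $n\ge 0$. -}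

module Defs where

open import Level using (Level; _⊔_)
open import Data.Nat using (ℕ; zero; suc)
import Data.Nat as ℕ
open import Data.List using (List; []; _∷_; length; map)
open import Data.Product using (∃; _×_)
open import Relation.Nullary using (¬_)
open import Algebra.Bundles using (CommutativeRing)

record Field (c ℓ : Level) : Set (Level.suc (c ⊔ ℓ)) where
  field
    commutativeRing : CommutativeRing c ℓ
  open CommutativeRing commutativeRing public
  field
    1≉0     : ¬ (1# ≈ 0#)
    inverse : ∀ x → ¬ (x ≈ 0#) → ∃ λ y → (x * y) ≈ 1#

module FieldNotions {c ℓ : Level} (F : Field c ℓ) where
  open Field F

  _·1 : ℕ → Carrier
  zero ·1  = 0#
  suc n ·1 = 1# + (n ·1)

  _^_ : Carrier → ℕ → Carrier
  x ^ zero  = 1#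
  x ^ suc n = x * (x ^ n)

  evalPoly : List Carrier → Carrier → Carrier
  evalPoly []       x = 0#
  evalPoly (a ∷ as) x = a + (x * evalPoly as x)

  HasChar : ℕ → Set ℓ
  HasChar p = (p ·1) ≈ 0#

  IsAlgebraicallyClosed : Set (c ⊔ ℓ)
  IsAlgebraicallyClosed =
    ∀ (cs : List Carrier) → ∃ λ x → ((x ^ suc (length cs)) + evalPoly cs x) ≈ 0#

  IsAlgebraicOverPrimeField : Carrier → Set ℓ
  IsAlgebraicOverPrimeField x =
    ∃ λ (cs : List ℕ) → ((x ^ suc (length cs)) + evalPoly (map _·1 cs) x) ≈ 0#

  IsAlgebraicClosureOfFp : ℕ → Set (c ⊔ ℓ)
  IsAlgebraicClosureOfFp p =
    HasChar p × IsAlgebraicallyClosed × (∀ x → IsAlgebraicOverPrimeField x)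

  U : Carrier → Carrier → ℕ → Carrier
  U P Q zero          = 0#
  U P Q (suc zero)    = 1#
  U P Q (suc (suc n)) = (P * U P Q (suc n)) - (Q * U P Q n)

  V : Carrier → Carrier → ℕ → Carrier
  V P Q zero          = 1# + 1#
  V P Q (suc zero)    = P
  V P Q (suc (suc n)) = (P * V P Q (suc n)) - (Q * V P Q n)

  -- U(P',Q') is an anti-derived sequence of order r of U(P,Q):
  -- U_r(P',Q') ≠ 0 and U_{nr}(P',Q') / U_r(P',Q') = U_n(P,Q) for all n
  -- (division by the nonzero U_r written multiplicatively)
  IsAntiDerived : ℕ → Carrier → Carrier → Carrier → Carrier → Set ℓ
  IsAntiDerived r P' Q' P Q =
    (¬ (U P' Q' r ≈ 0#)) × (∀ n → U P' Q' (n ℕ.* r) ≈ (U P' Q' r * U P Q n))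

{-# OPTIONS --safe #-}
module Submission where

-- Sequences with s (n + 2) = P s (n + 1) - Q s n are determined by s 0 and
-- s 1. By the addition formula U (2r + m) = V r U (r + m) - Q ^ r U m, the
-- sequence n ↦ U (n r) (P_r , Q_r) obeys the recurrence with parameters
-- (V_r , Q_r ^ r) = (P , Q) and starts with 0 , U_r, so it is U_r · U (P , Q).
-- From V_r² - D_r U_r² = 4 Q_r ^ r, U_r = 0 would force P² = 4 Q.
-- For existence take Q_r an r-th root of Q and P_r a root of V_r (x , Q_r) - P,
-- which as a polynomial in x is monic of degree r without x ^ (r - 1) term.

open import Defs
open import Level using (Level; 0ℓ; _⊔_)
open import Data.Nat as ℕ using (ℕ; zero; suc)
import Data.Nat.Properties as ℕ
open import Data.Nat.Divisibility using (_∣_)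
open import Data.Nat.Primality using (Prime)
open import Data.Product using (Σ; ∃; ∃₂; _×_; _,_; proj₁)
open import Data.Vec as Vec using (Vec; []; _∷_; _∷ʳ_; toList)
open import Data.Vec.Properties using (length-toList)
open import Data.Maybe using (just; nothing)
open import Data.Empty using (⊥-elim)
open import Relation.Nullary using (¬_; yes; no)
open import Relation.Binary.PropositionalEquality as ≡ using (_≡_; _≢_)
open import Relation.Binary.Definitions using (WeaklyDecidable)
open import Algebra.Bundles using (CommutativeRing; RawRing)
open import Algebra.Solver.Ring.AlmostCommutativeRing
  using (fromCommutativeRing; _-Raw-AlmostCommutative⟶_)

module IntegerCoefficients {c ℓ : Level} (R : CommutativeRing c ℓ) where
  open CommutativeRing R
  open import Algebra.Properties.Ring ring
    using (-0#≈0#; -‿+-comm; -‿distribˡ-*; -‿distribʳ-*; -‿involutive; ⁻¹-anti-homo‿-)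
  open import Algebra.Properties.CommutativeSemigroup +-commutativeSemigroup
    using (interchange)
  open import Algebra.Properties.Semiring.Mult semiring
    using (×-homo-+; ×1-homo-*) renaming (_×_ to _·_)
  open import Relation.Binary.Reasoning.Setoid setoid

  +-‿-interchange : ∀ x y z w → (x + z) - (y + w) ≈ (x - y) + (z - w)
  +-‿-interchange x y z w = begin
    (x + z) - (y + w)      ≈⟨ +-congˡ (-‿+-comm y w) ⟨
    (x + z) + (- y + - w)  ≈⟨ interchange x z (- y) (- w) ⟩
    (x - y) + (z - w)      ∎

  -x*-y≈x*y : ∀ x y → - x * - y ≈ x * y
  -x*-y≈x*y x y = begin
    - x * - y      ≈⟨ -‿distribˡ-* x (- y) ⟨
    - (x * - y)    ≈⟨ -‿cong (-‿distribʳ-* x y) ⟨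
    - (- (x * y))  ≈⟨ -‿involutive (x * y) ⟩
    x * y          ∎

  -‿*-‿-expand : ∀ x y z w → (x - y) * (z - w) ≈ (x * z + y * w) - (x * w + y * z)
  -‿*-‿-expand x y z w = begin
    (x - y) * (z - w)
      ≈⟨ distribʳ (z - w) x (- y) ⟩
    x * (z - w) + - y * (z - w)
      ≈⟨ +-cong (distribˡ x z (- w)) (distribˡ (- y) z (- w)) ⟩
    (x * z + x * - w) + (- y * z + - y * - w)
      ≈⟨ +-cong (+-congˡ (-‿distribʳ-* x w)) (+-cong (-‿distribˡ-* y z) (sym (-x*-y≈x*y y w))) ⟨
    (x * z - x * w) + (- (y * z) + y * w)
      ≈⟨ +-congˡ (+-comm (- (y * z)) (y * w)) ⟩
    (x * z - x * w) + (y * w - y * z)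
      ≈⟨ interchange (x * z) (- (x * w)) (y * w) (- (y * z)) ⟩
    (x * z + y * w) + (- (x * w) + - (y * z))
      ≈⟨ +-congˡ (-‿+-comm (x * w) (y * z)) ⟩
    (x * z + y * w) - (x * w + y * z) ∎

  +-‿-cancelˡ : ∀ x y z → (z + x) - (z + y) ≈ x - y
  +-‿-cancelˡ x y z = begin
    (z + x) - (z + y)  ≈⟨ +-‿-interchange z z x y ⟩
    (z - z) + (x - y)  ≈⟨ +-congʳ (-‿inverseʳ z) ⟩
    0# + (x - y)       ≈⟨ +-identityˡ (x - y) ⟩
    x - y              ∎

  -- Unlike n · 1# there is no trailing + 0#, so that the solver's
  -- constants 1 and 2 are definitionally 1# and 1# + 1#.
  numeral : ℕ → Carrier
  numeral zero          = 0#
  numeral (suc zero)    = 1#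
  numeral (suc (suc n)) = 1# + numeral (suc n)

  numeral≈·1# : ∀ n → numeral n ≈ n · 1#
  numeral≈·1# zero          = refl
  numeral≈·1# (suc zero)    = sym (+-identityʳ 1#)
  numeral≈·1# (suc (suc n)) = +-congˡ (numeral≈·1# (suc n))

  -- A pair (m , n) stands for the integer m - n; the operations keep pairs
  -- in the canonical form (m - n , 0) or (0 , n - m), since the solver
  -- compares normal forms syntactically.
  canonical : ℕ × ℕ → ℕ × ℕ
  canonical (a , b) = (a ℕ.∸ b , b ℕ.∸ a)

  Pairs : RawRing 0ℓ 0ℓ
  Pairs = record
    { Carrier = ℕ × ℕ
    ; _≈_     = _≡_
    ; _+_     = λ { (a , b) (c , d) → canonical (a ℕ.+ c , b ℕ.+ d) }
    ; _*_     = λ { (a , b) (c , d) → canonical (a ℕ.* c ℕ.+ b ℕ.* d , a ℕ.* d ℕ.+ b ℕ.* c) }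
    ; -_      = λ { (a , b) → (b , a) }
    ; 0#      = (0 , 0)
    ; 1#      = (1 , 0)
    }

  embed : ℕ × ℕ → Carrier
  embed (m , zero)  = numeral m
  embed (m , suc n) = numeral m - numeral (suc n)

  embed≈difference : ∀ m n → embed (m , n) ≈ m · 1# - n · 1#
  embed≈difference m zero = begin
    numeral m           ≈⟨ numeral≈·1# m ⟩
    m · 1#              ≈⟨ +-identityʳ (m · 1#) ⟨
    m · 1# + 0#         ≈⟨ +-congˡ -0#≈0# ⟨
    m · 1# - 0#         ∎
  embed≈difference m (suc n) = +-cong (numeral≈·1# m) (-‿cong (numeral≈·1# (suc n)))

  embed-canonical : ∀ m n → embed (canonical (m , n)) ≈ m · 1# - n · 1#
  embed-canonical zero    zero    = embed≈difference 0 0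
  embed-canonical zero    (suc n) = embed≈difference 0 (suc n)
  embed-canonical (suc m) zero    = embed≈difference (suc m) 0
  embed-canonical (suc m) (suc n) = begin
    embed (canonical (m , n))          ≈⟨ embed-canonical m n ⟩
    m · 1# - n · 1#                    ≈⟨ +-‿-cancelˡ (m · 1#) (n · 1#) 1# ⟨
    (1# + m · 1#) - (1# + n · 1#)      ∎

  embed-morphism : Pairs -Raw-AlmostCommutative⟶ fromCommutativeRing R
  embed-morphism = record
    { ⟦_⟧    = embed
    ; +-homo = λ { (a , b) (c , d) → begin
        embed (canonical (a ℕ.+ c , b ℕ.+ d))
          ≈⟨ embed-canonical (a ℕ.+ c) (b ℕ.+ d) ⟩
        (a ℕ.+ c) · 1# - (b ℕ.+ d) · 1#
          ≈⟨ +-cong (×-homo-+ 1# a c) (-‿cong (×-homo-+ 1# b d)) ⟩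
        (a · 1# + c · 1#) - (b · 1# + d · 1#)
          ≈⟨ +-‿-interchange (a · 1#) (b · 1#) (c · 1#) (d · 1#) ⟩
        (a · 1# - b · 1#) + (c · 1# - d · 1#)
          ≈⟨ +-cong (embed≈difference a b) (embed≈difference c d) ⟨
        embed (a , b) + embed (c , d) ∎ }
    ; *-homo = λ { (a , b) (c , d) → begin
        embed (canonical (a ℕ.* c ℕ.+ b ℕ.* d , a ℕ.* d ℕ.+ b ℕ.* c))
          ≈⟨ embed-canonical (a ℕ.* c ℕ.+ b ℕ.* d) (a ℕ.* d ℕ.+ b ℕ.* c) ⟩
        (a ℕ.* c ℕ.+ b ℕ.* d) · 1# - (a ℕ.* d ℕ.+ b ℕ.* c) · 1#
          ≈⟨ +-cong (×-homo-+-* a c b d) (-‿cong (×-homo-+-* a d b c)) ⟩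
        (a · 1# * (c · 1#) + b · 1# * (d · 1#)) - (a · 1# * (d · 1#) + b · 1# * (c · 1#))
          ≈⟨ -‿*-‿-expand (a · 1#) (b · 1#) (c · 1#) (d · 1#) ⟨
        (a · 1# - b · 1#) * (c · 1# - d · 1#)
          ≈⟨ *-cong (embed≈difference a b) (embed≈difference c d) ⟨
        embed (a , b) * embed (c , d) ∎ }
    ; -‿homo = λ { (a , b) → begin
        embed (b , a)           ≈⟨ embed≈difference b a ⟩
        b · 1# - a · 1#         ≈⟨ ⁻¹-anti-homo‿- (a · 1#) (b · 1#) ⟨
        - (a · 1# - b · 1#)     ≈⟨ -‿cong (embed≈difference a b) ⟨
        - embed (a , b)         ∎ }
    ; 0-homo = refl
    ; 1-homo = refl
    }
    where
    ×-homo-+-* : ∀ a c b d → (a ℕ.* c ℕ.+ b ℕ.* d) · 1# ≈ a · 1# * (c · 1#) + b · 1# * (d · 1#)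
    ×-homo-+-* a c b d =
      trans (×-homo-+ 1# (a ℕ.* c) (b ℕ.* d)) (+-cong (×1-homo-* a c) (×1-homo-* b d))

  embed-≟ : WeaklyDecidable (λ p q → embed p ≈ embed q)
  embed-≟ (a , b) (c , d) with a ℕ.≟ c | b ℕ.≟ d
  ... | yes ≡.refl | yes ≡.refl = just refl
  ... | _          | _          = nothing

  open import Algebra.Solver.Ring Pairs (fromCommutativeRing R) embed-morphism embed-≟ public

  lit : ∀ {k} → ℕ → Polynomial k
  lit n = con (n , 0)

module LucasSequences {c ℓ : Level} (F : Field c ℓ) where
  open Field F
  open FieldNotions F
  open IntegerCoefficients commutativeRing
    using (numeral; numeral≈·1#; solve; _:=_; _:+_; _:*_; _:-_; :-_; lit)
  open import Algebra.Properties.Ring ring using (x∙y⁻¹≈ε⇒x≈y)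
  open import Relation.Binary.Reasoning.Setoid setoid

  LucasRecurrent : Carrier → Carrier → (ℕ → Carrier) → Set ℓ
  LucasRecurrent P Q s = ∀ n → s (suc (suc n)) ≈ P * s (suc n) - Q * s n

  U-recurrent : ∀ P Q → LucasRecurrent P Q (U P Q)
  U-recurrent P Q n = refl

  V-recurrent : ∀ P Q → LucasRecurrent P Q (V P Q)
  V-recurrent P Q n = refl

  recurrent-cong : ∀ {P P′ Q Q′ s} → P ≈ P′ → Q ≈ Q′ →
                   LucasRecurrent P Q s → LucasRecurrent P′ Q′ s
  recurrent-cong P≈P′ Q≈Q′ rec n = trans (rec n) (+-cong (*-congʳ P≈P′) (-‿cong (*-congʳ Q≈Q′)))

  recurrent-scale : ∀ {P Q s} a → LucasRecurrent P Q s → LucasRecurrent P Q (λ n → a * s n)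
  recurrent-scale {P} {Q} {s} a rec n = begin
    a * s (suc (suc n))
      ≈⟨ *-congˡ (rec n) ⟩
    a * (P * s (suc n) - Q * s n)
      ≈⟨ solve 5 (λ a P Q x y → a :* (P :* y :- Q :* x) := P :* (a :* y) :- Q :* (a :* x))
               refl a P Q (s n) (s (suc n)) ⟩
    P * (a * s (suc n)) - Q * (a * s n) ∎

  recurrent-unique : ∀ {P Q s t} → LucasRecurrent P Q s → LucasRecurrent P Q t →
                     s 0 ≈ t 0 → s 1 ≈ t 1 → ∀ n → s n ≈ t n
  recurrent-unique {P} {Q} {s} {t} rec-s rec-t s₀≈t₀ s₁≈t₁ n = proj₁ (agree n)
    where
    agree : ∀ n → s n ≈ t n × s (suc n) ≈ t (suc n)
    agree zero    = s₀≈t₀ , s₁≈t₁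
    agree (suc n) with agree n
    ... | sₙ≈tₙ , sₙ₊₁≈tₙ₊₁ = sₙ₊₁≈tₙ₊₁ , (begin
      s (suc (suc n))             ≈⟨ rec-s n ⟩
      P * s (suc n) - Q * s n     ≈⟨ +-cong (*-congˡ sₙ₊₁≈tₙ₊₁) (-‿cong (*-congˡ sₙ≈tₙ)) ⟩
      P * t (suc n) - Q * t n     ≈⟨ rec-t n ⟨
      t (suc (suc n))             ∎)

  V≈2U-PU : ∀ P Q n → V P Q n ≈ (1# + 1#) * U P Q (suc n) - P * U P Q n
  V≈2U-PU P Q = recurrent-unique (V-recurrent P Q) rec
    (solve 1 (λ P → lit 2 := lit 2 :* lit 1 :- P :* lit 0) refl P)
    (solve 2 (λ P Q → P := lit 2 :* (P :* lit 1 :- Q :* lit 0) :- P :* lit 1) refl P Q)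
    where
    rec : LucasRecurrent P Q (λ n → (1# + 1#) * U P Q (suc n) - P * U P Q n)
    rec n = solve 4 (λ P Q a b →
        lit 2 :* (P :* (P :* b :- Q :* a) :- Q :* b) :- P :* (P :* b :- Q :* a)
        := P :* (lit 2 :* (P :* b :- Q :* a) :- P :* b) :- Q :* (lit 2 :* b :- P :* a))
      refl P Q (U P Q n) (U P Q (suc n))

  U-cassini : ∀ P Q n →
    U P Q (suc n) * U P Q (suc n) - P * U P Q (suc n) * U P Q n + Q * U P Q n * U P Q n ≈ Q ^ n
  U-cassini P Q zero =
    solve 2 (λ P Q → lit 1 :* lit 1 :- P :* lit 1 :* lit 0 :+ Q :* lit 0 :* lit 0 := lit 1) refl P Q
  U-cassini P Q (suc n) = begin
    U P Q (suc (suc n)) * U P Q (suc (suc n)) - P * U P Q (suc (suc n)) * U P Q (suc n)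
      + Q * U P Q (suc n) * U P Q (suc n)
      ≈⟨ solve 4 (λ P Q a b →
           (P :* b :- Q :* a) :* (P :* b :- Q :* a) :- P :* (P :* b :- Q :* a) :* b :+ Q :* b :* b
           := Q :* (b :* b :- P :* b :* a :+ Q :* a :* a))
         refl P Q (U P Q n) (U P Q (suc n)) ⟩
    Q * (U P Q (suc n) * U P Q (suc n) - P * U P Q (suc n) * U P Q n + Q * U P Q n * U P Q n)
      ≈⟨ *-congˡ (U-cassini P Q n) ⟩
    Q * Q ^ n ∎

  V²-DU² : ∀ P Q n →
    V P Q n * V P Q n - (P * P - numeral 4 * Q) * (U P Q n * U P Q n) ≈ numeral 4 * Q ^ n
  V²-DU² P Q n = begin
    V P Q n * V P Q n - (P * P - numeral 4 * Q) * (a * a)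
      ≈⟨ +-congʳ (*-cong (V≈2U-PU P Q n) (V≈2U-PU P Q n)) ⟩
    ((1# + 1#) * b - P * a) * ((1# + 1#) * b - P * a) - (P * P - numeral 4 * Q) * (a * a)
      ≈⟨ solve 4 (λ P Q a b →
           (lit 2 :* b :- P :* a) :* (lit 2 :* b :- P :* a) :- (P :* P :- lit 4 :* Q) :* (a :* a)
           := lit 4 :* (b :* b :- P :* b :* a :+ Q :* a :* a))
         refl P Q a b ⟩
    numeral 4 * (b * b - P * b * a + Q * a * a)
      ≈⟨ *-congˡ (U-cassini P Q n) ⟩
    numeral 4 * Q ^ n ∎
    where
    a = U P Q n
    b = U P Q (suc n)

  U-double-add : ∀ P Q k m →
    U P Q (k ℕ.+ (k ℕ.+ m)) ≈ V P Q k * U P Q (k ℕ.+ m) - Q ^ k * U P Q m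
  U-double-add P Q zero m =
    solve 1 (λ u → u := lit 2 :* u :- lit 1 :* u) refl (U P Q m)
  U-double-add P Q (suc zero) m =
    solve 4 (λ P Q a b → P :* b :- Q :* a := P :* b :- Q :* lit 1 :* a) refl P Q (U P Q m) (U P Q (suc m))
  U-double-add P Q (suc (suc k)) m = begin
    P * U P Q (suc X) - Q * U P Q X
      ≈⟨ +-cong (*-congˡ (trans (U-index index₁) (U-double-add P Q (suc k) (suc m))))
                (-‿cong (*-congˡ (trans (U-index index₂) (U-double-add P Q k (suc (suc m)))))) ⟩
    P * (V P Q (suc k) * U P Q (suc k ℕ.+ suc m) - Q ^ suc k * B)
      - Q * (V P Q k * U P Q (k ℕ.+ suc (suc m)) - Q ^ k * (P * B - Q * A))
      ≈⟨ +-cong (*-congˡ (+-congʳ (*-congˡ (U-index (ℕ.+-suc (suc k) m)))))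
                (-‿cong (*-congˡ (+-congʳ (*-congˡ (U-index index₃))))) ⟩
    P * (V P Q (suc k) * Y - Q * Q ^ k * B) - Q * (V P Q k * Y - Q ^ k * (P * B - Q * A))
      ≈⟨ solve 8 (λ P Q q v₁ v₀ y a b →
           P :* (v₁ :* y :- Q :* q :* b) :- Q :* (v₀ :* y :- q :* (P :* b :- Q :* a))
           := (P :* v₁ :- Q :* v₀) :* y :- Q :* (Q :* q) :* a)
         refl P Q (Q ^ k) (V P Q (suc k)) (V P Q k) Y A B ⟩
    V P Q (suc (suc k)) * Y - Q ^ suc (suc k) * A ∎
    where
    X = k ℕ.+ suc (suc (k ℕ.+ m))
    Y = U P Q (suc (suc (k ℕ.+ m)))
    A = U P Q m
    B = U P Q (suc m)
    U-index : ∀ {i j} → i ≡ j → U P Q i ≈ U P Q j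
    U-index i≡j = reflexive (≡.cong (U P Q) i≡j)
    index₁ : suc X ≡ suc k ℕ.+ (suc k ℕ.+ suc m)
    index₁ = ≡.cong (λ t → suc (k ℕ.+ suc t)) (≡.sym (ℕ.+-suc k m))
    index₃ : k ℕ.+ suc (suc m) ≡ suc (suc (k ℕ.+ m))
    index₃ = ≡.trans (ℕ.+-suc k (suc m)) (≡.cong suc (ℕ.+-suc k m))
    index₂ : X ≡ k ℕ.+ (k ℕ.+ suc (suc m))
    index₂ = ≡.cong (k ℕ.+_) (≡.sym index₃)

  U-multiples : ∀ {P Q P′ Q′} r → V P′ Q′ r ≈ P → Q′ ^ r ≈ Q →
                ∀ n → U P′ Q′ (n ℕ.* r) ≈ U P′ Q′ r * U P Q n
  U-multiples {P} {Q} {P′} {Q′} r Vᵣ≈P Q′ʳ≈Q = recurrent-unique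
    (recurrent-cong Vᵣ≈P Q′ʳ≈Q (λ n → U-double-add P′ Q′ r (n ℕ.* r)))
    (recurrent-scale (U P′ Q′ r) (U-recurrent P Q))
    (sym (zeroʳ (U P′ Q′ r)))
    (trans (reflexive (≡.cong (U P′ Q′) (ℕ.+-identityʳ r))) (sym (*-identityʳ (U P′ Q′ r))))

  U-nonvanishing : ∀ {P Q P′ Q′} r → V P′ Q′ r ≈ P → Q′ ^ r ≈ Q →
                   ¬ (P * P - (4 ·1) * Q ≈ 0#) → ¬ (U P′ Q′ r ≈ 0#)
  U-nonvanishing {P} {Q} {P′} {Q′} r Vᵣ≈P Q′ʳ≈Q D≉0 Uᵣ≈0 = D≉0 (begin
    P * P - (4 ·1) * Q
      ≈⟨ +-cong (*-cong Vᵣ≈P Vᵣ≈P) (-‿cong (*-cong (numeral≈·1# 4) Q′ʳ≈Q)) ⟨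
    v * v - numeral 4 * Q′ ^ r
      ≈⟨ +-congˡ (-‿cong (V²-DU² P′ Q′ r)) ⟨
    v * v - (v * v - D′ * (u * u))
      ≈⟨ +-congˡ (-‿cong (+-congˡ (-‿cong (*-congˡ (*-cong Uᵣ≈0 Uᵣ≈0))))) ⟩
    v * v - (v * v - D′ * (0# * 0#))
      ≈⟨ solve 2 (λ v d → v :* v :- (v :* v :- d :* (lit 0 :* lit 0)) := lit 0) refl v D′ ⟩
    0# ∎)
    where
    v = V P′ Q′ r
    u = U P′ Q′ r
    D′ = P′ * P′ - numeral 4 * Q′

  evalPoly-zeros : ∀ n x → evalPoly (toList (Vec.replicate n 0#)) x ≈ 0#
  evalPoly-zeros zero    x = refl
  evalPoly-zeros (suc n) x = begin
    0# + x * evalPoly (toList (Vec.replicate n 0#)) x  ≈⟨ +-congˡ (*-congˡ (evalPoly-zeros n x)) ⟩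
    0# + x * 0#                                        ≈⟨ solve 1 (λ x → lit 0 :+ x :* lit 0 := lit 0) refl x ⟩
    0#                                                 ∎

  evalPoly-zipWith-+ : ∀ {n} (as bs : Vec Carrier n) x →
    evalPoly (toList (Vec.zipWith _+_ as bs)) x ≈ evalPoly (toList as) x + evalPoly (toList bs) x
  evalPoly-zipWith-+ []       []       x = sym (+-identityˡ 0#)
  evalPoly-zipWith-+ (a ∷ as) (b ∷ bs) x = begin
    (a + b) + x * evalPoly (toList (Vec.zipWith _+_ as bs)) x
      ≈⟨ +-congˡ (*-congˡ (evalPoly-zipWith-+ as bs x)) ⟩
    (a + b) + x * (evalPoly (toList as) x + evalPoly (toList bs) x)
      ≈⟨ solve 5 (λ a b x e f → (a :+ b) :+ x :* (e :+ f) := (a :+ x :* e) :+ (b :+ x :* f))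
               refl a b x (evalPoly (toList as) x) (evalPoly (toList bs) x) ⟩
    (a + x * evalPoly (toList as) x) + (b + x * evalPoly (toList bs) x) ∎

  evalPoly-map-* : ∀ {n} a (cs : Vec Carrier n) x →
    evalPoly (toList (Vec.map (a *_) cs)) x ≈ a * evalPoly (toList cs) x
  evalPoly-map-* a []       x = sym (zeroʳ a)
  evalPoly-map-* a (c ∷ cs) x = begin
    a * c + x * evalPoly (toList (Vec.map (a *_) cs)) x
      ≈⟨ +-congˡ (*-congˡ (evalPoly-map-* a cs x)) ⟩
    a * c + x * (a * evalPoly (toList cs) x)
      ≈⟨ solve 4 (λ a c x e → a :* c :+ x :* (a :* e) := a :* (c :+ x :* e))
               refl a c x (evalPoly (toList cs) x) ⟩
    a * (c + x * evalPoly (toList cs) x) ∎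

  evalPoly-∷ʳ : ∀ {n} (cs : Vec Carrier n) a x →
    evalPoly (toList (cs ∷ʳ a)) x ≈ evalPoly (toList cs) x + x ^ n * a
  evalPoly-∷ʳ []       a x = solve 2 (λ a x → a :+ x :* lit 0 := lit 0 :+ lit 1 :* a) refl a x
  evalPoly-∷ʳ {suc n} (c ∷ cs) a x = begin
    c + x * evalPoly (toList (cs ∷ʳ a)) x
      ≈⟨ +-congˡ (*-congˡ (evalPoly-∷ʳ cs a x)) ⟩
    c + x * (evalPoly (toList cs) x + x ^ n * a)
      ≈⟨ solve 5 (λ c x e w a → c :+ x :* (e :+ w :* a) := (c :+ x :* e) :+ x :* w :* a)
               refl c x (evalPoly (toList cs) x) (x ^ n) a ⟩
    (c + x * evalPoly (toList cs) x) + x * x ^ n * a ∎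

  -- Monic of degree n + 1 with no term of degree n: the polynomials that
  -- IsAlgebraicallyClosed provides roots for.
  IsDepressedMonic : ℕ → (Carrier → Carrier) → Set (c ⊔ ℓ)
  IsDepressedMonic n f = Σ (Vec Carrier n) λ cs → ∀ x → f x ≈ x ^ suc n + evalPoly (toList cs) x

  depressed-root : IsAlgebraicallyClosed → ∀ {n f} → IsDepressedMonic n f → ∃ λ x → f x ≈ 0#
  depressed-root closed (cs , f≈) with closed (toList cs)
  ... | x , root = x , trans (f≈ x)
    (≡.subst (λ d → x ^ suc d + evalPoly (toList cs) x ≈ 0#) (length-toList cs) root)

  depressed-sub-constant : ∀ {n f} a → IsDepressedMonic (suc n) f → IsDepressedMonic (suc n) (λ x → f x - a)
  depressed-sub-constant {n} a (c ∷ cs , f≈) = c - a ∷ cs , λ x → begin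
    _ - a
      ≈⟨ +-congʳ (f≈ x) ⟩
    (x ^ suc (suc n) + (c + x * evalPoly (toList cs) x)) - a
      ≈⟨ solve 5 (λ w c x e a → (w :+ (c :+ x :* e)) :- a := w :+ ((c :- a) :+ x :* e))
               refl (x ^ suc (suc n)) c x (evalPoly (toList cs) x) a ⟩
    x ^ suc (suc n) + ((c - a) + x * evalPoly (toList cs) x) ∎

  power-depressed : ∀ n → IsDepressedMonic n (_^ suc n)
  power-depressed n = Vec.replicate n 0# , λ x →
    sym (trans (+-congˡ (evalPoly-zeros n x)) (+-identityʳ (x ^ suc n)))

  -- V_{n+2}(x, q) = x ^ (n + 2) - (n + 2) q x ^ n + …, as a polynomial in x.
  V-depressed : ∀ q n → IsDepressedMonic (suc n) (λ x → V x q (suc (suc n)))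
  V-depressed q n = proj₁ (consecutive n)
    where
    consecutive : ∀ n → IsDepressedMonic (suc n) (λ x → V x q (suc (suc n)))
                      × IsDepressedMonic (suc (suc n)) (λ x → V x q (suc (suc (suc n))))
    consecutive zero =
      (- (q * (1# + 1#)) ∷ [] , λ x →
        solve 2 (λ x q → x :* x :- q :* lit 2 := x :* (x :* lit 1) :+ (:- (q :* lit 2) :+ x :* lit 0))
          refl x q) ,
      (0# ∷ - (q * (1# + (1# + 1#))) ∷ [] , λ x →
        solve 2 (λ x q → x :* (x :* x :- q :* lit 2) :- q :* x
                         := x :* (x :* (x :* lit 1)) :+ (lit 0 :+ x :* (:- (q :* lit 3) :+ x :* lit 0)))
          refl x q)
    consecutive (suc n) with consecutive n
    ... | (A , V≈A) , (B , V≈B) = (B , V≈B) , (cs , λ x → begin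
      x * V x q (3 ℕ.+ n) - q * V x q (2 ℕ.+ n)
        ≈⟨ +-cong (*-congˡ (V≈B x)) (-‿cong (*-congˡ (V≈A x))) ⟩
      x * (x ^ (3 ℕ.+ n) + evalPoly (toList B) x) - q * (x ^ (2 ℕ.+ n) + evalPoly (toList A) x)
        ≈⟨ solve 5 (λ x q w a b →
             x :* (x :* (x :* w) :+ b) :- q :* (x :* w :+ a)
             := x :* (x :* (x :* w)) :+ ((lit 0 :+ x :* b) :+ ((:- q :* a :+ w :* lit 0) :+ x :* w :* :- q)))
           refl x q (x ^ suc n) (evalPoly (toList A) x) (evalPoly (toList B) x) ⟩
      x ^ (4 ℕ.+ n) + ((0# + x * evalPoly (toList B) x)
                      + ((- q * evalPoly (toList A) x + x ^ suc n * 0#) + x ^ (2 ℕ.+ n) * - q))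
        ≈⟨ +-congˡ (evalPoly-cs x) ⟨
      x ^ (4 ℕ.+ n) + evalPoly (toList cs) x ∎)
      where
      -- x · V_{n+3} contributes 0 ∷ B, and - q · V_{n+2} contributes
      -- - q · A together with the term - q x ^ (n + 2).
      Aq : Vec Carrier (suc n)
      Aq = Vec.map (- q *_) A
      cs : Vec Carrier (3 ℕ.+ n)
      cs = Vec.zipWith _+_ (0# ∷ B) (Aq ∷ʳ 0# ∷ʳ - q)
      evalPoly-cs : ∀ x → evalPoly (toList cs) x ≈ (0# + x * evalPoly (toList B) x)
                      + ((- q * evalPoly (toList A) x + x ^ suc n * 0#) + x ^ (2 ℕ.+ n) * - q)
      evalPoly-cs x =
        trans (evalPoly-zipWith-+ (0# ∷ B) (Aq ∷ʳ 0# ∷ʳ - q) x)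
              (+-congˡ (trans (evalPoly-∷ʳ (Aq ∷ʳ 0#) (- q) x)
                              (+-congʳ (trans (evalPoly-∷ʳ Aq 0# x)
                                              (+-congʳ (evalPoly-map-* (- q) A x))))))

  lucas-parameters : IsAlgebraicallyClosed → ∀ P Q r → r ≢ 0 →
                     ∃₂ λ Pr Qr → Qr ^ r ≈ Q × V Pr Qr r ≈ P
  lucas-parameters closed P Q zero          r≢0 = ⊥-elim (r≢0 ≡.refl)
  lucas-parameters closed P Q (suc zero)    _   = P , Q , *-identityʳ Q , refl
  lucas-parameters closed P Q (suc (suc n)) _
    with depressed-root closed (depressed-sub-constant Q (power-depressed (suc n)))
  ... | q , qʳ-Q≈0 with depressed-root closed (depressed-sub-constant P (V-depressed q n))
  ... | p , Vᵣ-P≈0 = p , q , x∙y⁻¹≈ε⇒x≈y _ _ qʳ-Q≈0 , x∙y⁻¹≈ε⇒x≈y _ _ Vᵣ-P≈0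

lemma3p1 : ∀ {c ℓ : Level} (p : ℕ) → Prime p → p ≢ 2 →
    (F : Field c ℓ) → let open Field F in let open FieldNotions F in
    IsAlgebraicClosureOfFp p →
    ∀ (P Q : Carrier) → ¬ (P ≈ 0#) → ¬ (Q ≈ 0#) →
    ¬ (((P * P) - ((4 ·1) * Q)) ≈ 0#) →
    ∀ (r : ℕ) → r ≢ 0 → ¬ (p ∣ r) →
    (∃₂ λ Pr Qr → ((Qr ^ r) ≈ Q) × (V Pr Qr r ≈ P))
    × (∀ Pr Qr → (Qr ^ r) ≈ Q → V Pr Qr r ≈ P → IsAntiDerived r Pr Qr P Q)
lemma3p1 _ _ _ F (_ , closed , _) P Q _ _ D≉0 r r≢0 _ =
  lucas-parameters closed P Q r r≢0 ,
  λ Pr Qr Qrʳ≈Q Vr≈P → U-nonvanishing r Vr≈P Qrʳ≈Q D≉0 , U-multiples r Vr≈P Qrʳ≈Q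
  where open LucasSequences F
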